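{- Let $G$ be a graph and let $v,v'$ be vertices of $G$ that are twins, i.e. $N[v]=N[v']$. Then for every cluster deletion set $S$ of $G$ of minimum size, $v\in S$ if and only if $v'\in S$.
   Context: $N[v]$ denotes the closed neighborhood of $v$ ($v$ together with its neighbors). A graph is a cluster graph if every connected component is a clique. A set $S$ of vertices of $G$ is a cluster deletion set of $G$ if $G-S$ (the graph obtained by deleting the vertices of $S$) is a cluster graph. -}

module Defs where

open import Data.Nat using (ℕ; _≤_)
open import Data.Fin using (Fin)
open import Data.Fin.Subset using (Subset; _∈_; _∉_; ∣_∣)
open import Data.Product using (_×_)
open import Data.Sum using (_⊎_)
open import Relation.Nullary using (¬_)
open import Relation.Binary.PropositionalEquality using (_≡_; _≢_)

record Graph (n : ℕ) : Set₁ where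
  field
    Adj     : Fin n → Fin n → Set
    sym     : ∀ {x y} → Adj x y → Adj y x
    irrefl  : ∀ {x} → ¬ Adj x x
open Graph public

InClosedNbhd : ∀ {n} → Graph n → Fin n → Fin n → Set
InClosedNbhd G v u = (u ≡ v) ⊎ Adj G v u

Twins : ∀ {n} → Graph n → Fin n → Fin n → Set
Twins G v v' = ∀ u → (InClosedNbhd G v u → InClosedNbhd G v' u)
                   × (InClosedNbhd G v' u → InClosedNbhd G v u)

data ConnectedIn {n} (G : Graph n) (S : Subset n) : Fin n → Fin n → Set where
  here : ∀ {x} → x ∉ S → ConnectedIn G S x x
  step : ∀ {x y z} → x ∉ S → Adj G x y → ConnectedIn G S y z → ConnectedIn G S x z

-- G - S is a cluster graph: every connected component is a clique,
-- i.e. any two distinct vertices in the same component of G - S are adjacent.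
IsClusterDeletionSet : ∀ {n} → Graph n → Subset n → Set
IsClusterDeletionSet G S =
  ∀ x y → ConnectedIn G S x y → x ≢ y → Adj G x y

IsMinCDS : ∀ {n} → Graph n → Subset n → Set
IsMinCDS G S = IsClusterDeletionSet G S
             × (∀ T → IsClusterDeletionSet G T → ∣ S ∣ ≤ ∣ T ∣)

-- If a minimum cluster deletion set S contained v but not its twin v', then S - v would
-- still be a cluster deletion set: the map sending v to v' and fixing every other vertex
-- carries connections in G - (S - v) to connections in G - S and preserves and reflects closed
-- adjacency, because v and v' have the same closed neighbourhood. This contradicts minimality.
module Submission where

open import Defs
open import Data.Nat.Properties using (<⇒≱)
open import Data.Fin using (Fin)
open import Data.Fin.Properties using (_≟_)
open import Data.Fin.Subset using (Subset; _∈_; _∉_; _-_)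
open import Data.Fin.Subset.Properties using (_∈?_; x∈p∧x≢y⇒x∈p-y; x∈p⇒∣p-x∣<∣p∣)
open import Data.Product using (_×_; _,_; proj₁; proj₂)
open import Data.Sum using (inj₁; inj₂)
open import Function using (id)
open import Relation.Nullary using (yes; no; contradiction)
open import Relation.Binary.PropositionalEquality using (_≢_; refl; subst)
  renaming (sym to ≡-sym)

module _ {n} (G : Graph n) where

  InClosedNbhd-sym : ∀ {u v} → InClosedNbhd G u v → InClosedNbhd G v u
  InClosedNbhd-sym (inj₁ refl) = inj₁ refl
  InClosedNbhd-sym (inj₂ a)    = inj₂ (sym G a)

  InClosedNbhd⇒Adj : ∀ {u v} → u ≢ v → InClosedNbhd G u v → Adj G u v
  InClosedNbhd⇒Adj u≢v (inj₁ v≡u) = contradiction (≡-sym v≡u) u≢v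
  InClosedNbhd⇒Adj u≢v (inj₂ a)   = a

  Twins-refl : ∀ {v} → Twins G v v
  Twins-refl u = id , id

  Twins-sym : ∀ {v v'} → Twins G v v' → Twins G v' v
  Twins-sym tw u = proj₂ (tw u) , proj₁ (tw u)

  InClosedNbhd-twins : ∀ {u u' v v'} → Twins G u u' → Twins G v v' →
                       InClosedNbhd G u v → InClosedNbhd G u' v'
  InClosedNbhd-twins {u} {v' = v'} tu tv u~v =
    proj₁ (tu v') (InClosedNbhd-sym (proj₁ (tv u) (InClosedNbhd-sym u~v)))

  module TwinMap (f : Fin n → Fin n) (f-twin : ∀ x → Twins G x (f x))
                 {S T : Subset n} (f-avoids : ∀ {x} → x ∉ T → f x ∉ S) where

    connectedIn-map : ∀ {x y} → ConnectedIn G T x y → ConnectedIn G S (f x) (f y)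
    connectedIn-map (here x∉T) = here (f-avoids x∉T)
    connectedIn-map {x} {z} (step {y = y} x∉T x~y y⇝z)
      with InClosedNbhd-twins (f-twin x) (f-twin y) (inj₂ x~y)
    ... | inj₁ fy≡fx = subst (λ w → ConnectedIn G S w (f z)) fy≡fx (connectedIn-map y⇝z)
    ... | inj₂ fx~fy = step (f-avoids x∉T) fx~fy (connectedIn-map y⇝z)

    isClusterDeletionSet : IsClusterDeletionSet G S → IsClusterDeletionSet G T
    isClusterDeletionSet cds x y x⇝y x≢y =
      InClosedNbhd⇒Adj x≢y
        (InClosedNbhd-twins (Twins-sym (f-twin x)) (Twins-sym (f-twin y)) fx~fy)
      where
      fx~fy : InClosedNbhd G (f x) (f y)
      fx~fy with f x ≟ f y
      ... | yes fx≡fy = inj₁ (≡-sym fx≡fy)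
      ... | no fx≢fy  = inj₂ (cds (f x) (f y) (connectedIn-map x⇝y) fx≢fy)

  module _ {v v'} (tw : Twins G v v') where

    replace : Fin n → Fin n
    replace x with x ≟ v
    ... | yes _ = v'
    ... | no _  = x

    replace-twin : ∀ x → Twins G x (replace x)
    replace-twin x with x ≟ v
    ... | yes refl = tw
    ... | no _     = Twins-refl

    replace-avoids : ∀ {S x} → v' ∉ S → x ∉ S - v → replace x ∉ S
    replace-avoids {x = x} v'∉S x∉S-v with x ≟ v
    ... | yes _   = v'∉S
    ... | no x≢v  = λ x∈S → x∉S-v (x∈p∧x≢y⇒x∈p-y x∈S x≢v)

    IsClusterDeletionSet-removeTwin : ∀ {S} → v' ∉ S →
      IsClusterDeletionSet G S → IsClusterDeletionSet G (S - v)
    IsClusterDeletionSet-removeTwin v'∉S =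
      TwinMap.isClusterDeletionSet replace replace-twin (replace-avoids v'∉S)

    IsMinCDS-twin-∈ : ∀ {S} → IsMinCDS G S → v ∈ S → v' ∈ S
    IsMinCDS-twin-∈ {S} (cds , minimal) v∈S with v' ∈? S
    ... | yes v'∈S = v'∈S
    ... | no v'∉S  = contradiction
      (minimal (S - v) (IsClusterDeletionSet-removeTwin v'∉S cds))
      (<⇒≱ (x∈p⇒∣p-x∣<∣p∣ v∈S))

lemma2 : ∀ {n} (G : Graph n) (v v' : Fin n) → Twins G v v' →
         ∀ (S : Subset n) → IsMinCDS G S →
         (v ∈ S → v' ∈ S) × (v' ∈ S → v ∈ S)
lemma2 G v v' tw S min = IsMinCDS-twin-∈ G tw min , IsMinCDS-twin-∈ G (Twins-sym G tw) min
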